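{- Let $\mathscr{M}$ and $\mathscr{N}$ be minions and $h\in\mathbb{N}$. Then there is a partial homomorphism up to arity $h$ from $\mathscr{M}$ to $\mathscr{N}$ if and only if there is a minion homomorphism $\mathscr{M}\to\mathscr{N}^{(h)}$.
   Context: Minions: disjoint sets $\mathscr{M}(n)$, $n\in\mathbb{N}$, with maps $f\mapsto f^\pi\in\mathscr{M}(m)$ for $\pi:[n]\to[m]$, satisfying $f^{\mathrm{id}}=f$ and $f^{\pi_1\circ\pi_2}=(f^{\pi_2})^{\pi_1}$. A minion homomorphism $F:\mathscr{M}\to\mathscr{N}$ preserves arities and satisfies $F(f^\pi)=F(f)^\pi$. A partial homomorphism up to arity $h$ is an arity-preserving map defined exactly on the elements of arity at most $h$ satisfying $F(f^\pi)=F(f)^\pi$ whenever $f$ and $f^\pi$ have arity at most $h$. $h$-dimensional closure $\mathscr{N}^{(h)}$: an $m$-ary system of $h$-ary minors is a map $\zeta:[h]^{[m]}\to\mathscr{N}(h)$ with $\zeta(\pi_2)^\sigma=\zeta(\pi_1)$ whenever $\pi_1=\sigma\circ\pi_2$ ($\pi_1,\pi_2\in[h]^{[m]}$, $\sigma\in[h]^{[h]}$); $\mathscr{N}^{(h)}(m)$ is the set of $m$-ary systems, and for $\sigma:[m]\to[n]$, $\zeta^\sigma$ is $\pi\mapsto\zeta(\pi\circ\sigma)$. -}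

module Defs where

open import Data.Nat using (ℕ; zero; suc; _≤_)
open import Data.Fin using (Fin)
open import Data.Unit using (⊤; tt)
open import Data.Product using (_×_)
open import Function using (_∘_; id)
open import Relation.Binary.PropositionalEquality using (_≡_; refl; sym; trans; cong)

-- Arities are positive.  Convention: the carrier
-- `Carrier n` is the set of elements of arity (suc n), i.e. with
-- coordinate set  ⟦ n ⟧ = Fin (suc n)  ≅ [suc n].
-- Minions are taken over setoids (each arity carries an equivalence
-- relation); ordinary set-based minions are the case _≈_ = _≡_.

Ar : ℕ → Set
Ar n = Fin (suc n)

record Minion : Set₁ where
  infix 4 _≈_
  field
    Carrier    : ℕ → Set
    _≈_        : ∀ {n} → Carrier n → Carrier n → Set
    ≈-refl     : ∀ {n} {f : Carrier n} → f ≈ f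
    ≈-sym      : ∀ {n} {f g : Carrier n} → f ≈ g → g ≈ f
    ≈-trans    : ∀ {n} {f g k : Carrier n} → f ≈ g → g ≈ k → f ≈ k
    minor      : ∀ {n m} → Carrier n → (Ar n → Ar m) → Carrier m
    minor-cong : ∀ {n m} {f g : Carrier n} {π π′ : Ar n → Ar m} →
                 f ≈ g → (∀ i → π i ≡ π′ i) → minor f π ≈ minor g π′
    minor-id   : ∀ {n} (f : Carrier n) → minor f id ≈ f
    minor-∘    : ∀ {n k m} (f : Carrier n) (π₁ : Ar k → Ar m) (π₂ : Ar n → Ar k) →
                 minor f (π₁ ∘ π₂) ≈ minor (minor f π₂) π₁

record Hom (M N : Minion) : Set where
  private
    module M = Minion M
    module N = Minion N
  field
    map      : ∀ {n} → M.Carrier n → N.Carrier n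
    map-cong : ∀ {n} {f g : M.Carrier n} → f M.≈ g → map f N.≈ map g
    map-minor : ∀ {n m} (f : M.Carrier n) (π : Ar n → Ar m) →
                map (M.minor f π) N.≈ N.minor (map f) π

record PartialHom (h : ℕ) (M N : Minion) : Set where
  private
    module M = Minion M
    module N = Minion N
  field
    map       : ∀ {n} → suc n ≤ h → M.Carrier n → N.Carrier n
    map-cong  : ∀ {n} (p : suc n ≤ h) {f g : M.Carrier n} →
                f M.≈ g → map p f N.≈ map p g
    map-minor : ∀ {n m} (p : suc n ≤ h) (q : suc m ≤ h)
                (f : M.Carrier n) (π : Ar n → Ar m) →
                map q (M.minor f π) N.≈ N.minor (map p f) π

module Closure (N : Minion) where
  open Minion N

  -- N(h) as a setoid with the action of [h]^[h]; for h = 0 there are no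
  -- maps [m] → [0] (m ≥ 1), so the value of the codomain is irrelevant.
  Cod : ℕ → Set
  Cod zero    = ⊤
  Cod (suc k) = Carrier k

  EqC : ∀ h → Cod h → Cod h → Set
  EqC zero    _ _ = ⊤
  EqC (suc k) x y = x ≈ y

  minorC : ∀ h → Cod h → (Fin h → Fin h) → Cod h
  minorC zero    x σ = tt
  minorC (suc k) x σ = minor x σ

  record System (h m : ℕ) : Set where
    field
      ζ      : (Ar m → Fin h) → Cod h
      system : ∀ (π₁ π₂ : Ar m → Fin h) (σ : Fin h → Fin h) →
               (∀ i → π₁ i ≡ σ (π₂ i)) → EqC h (minorC h (ζ π₂) σ) (ζ π₁)
  open System public

  _≈S_ : ∀ {h m} → System h m → System h m → Set
  _≈S_ {h} Z Z′ = ∀ π → EqC h (ζ Z π) (ζ Z′ π)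

  ≈C-refl : ∀ h {x : Cod h} → EqC h x x
  ≈C-refl zero    = tt
  ≈C-refl (suc k) = ≈-refl

  ≈C-sym : ∀ h {x y : Cod h} → EqC h x y → EqC h y x
  ≈C-sym zero    _ = tt
  ≈C-sym (suc k) e = ≈-sym e

  ≈C-trans : ∀ h {x y z : Cod h} → EqC h x y → EqC h y z → EqC h x z
  ≈C-trans zero    _ _ = tt
  ≈C-trans (suc k) e f = ≈-trans e f

  minorC-id : ∀ h (x : Cod h) → EqC h (minorC h x id) x
  minorC-id zero    x = tt
  minorC-id (suc k) x = minor-id x

  ζ-cong : ∀ h {m} (Z : System h m) {π π′ : Ar m → Fin h} →
           (∀ i → π i ≡ π′ i) → EqC h (ζ Z π) (ζ Z π′)
  ζ-cong h Z {π} {π′} e =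
    ≈C-sym h (≈C-trans h (≈C-sym h (minorC-id h (ζ Z π′))) (system Z π π′ id e))

  sysMinor : ∀ {h n m} → System h n → (Ar n → Ar m) → System h m
  ζ      (sysMinor Z σ) π = ζ Z (π ∘ σ)
  system (sysMinor Z σ) π₁ π₂ τ e = system Z (π₁ ∘ σ) (π₂ ∘ σ) τ (e ∘ σ)

  closure : ℕ → Minion
  closure h = record
    { Carrier    = System h
    ; _≈_        = _≈S_
    ; ≈-refl     = λ π → ≈C-refl h
    ; ≈-sym      = λ e π → ≈C-sym h (e π)
    ; ≈-trans    = λ e f π → ≈C-trans h (e π) (f π)
    ; minor      = sysMinor
    ; minor-cong = λ {_} {_} {Z} {Z′} e eσ π →
                     ≈C-trans h (ζ-cong h Z (λ i → cong π (eσ i))) (e _)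
    ; minor-id   = λ f π → ≈C-refl h
    ; minor-∘    = λ f π₁ π₂ π → ≈C-refl h
    }

_⁽_⁾ : Minion → ℕ → Minion
N ⁽ h ⁾ = Closure.closure N h

module Submission where

open import Defs
open import Data.Nat using (ℕ; zero; suc; _≤_; z≤n; s≤s)
open import Data.Nat.Properties using (≤-refl)
open import Data.Fin using (Fin; zero; suc; inject≤)
open import Data.Unit using (tt)
open import Data.Product using (_×_; _,_)
open import Function using (_∘_)
open import Level using (0ℓ)
open import Relation.Binary.Bundles using (Setoid)
open import Relation.Binary.PropositionalEquality using (_≡_; refl; sym; cong)
import Relation.Binary.Reasoning.Setoid as SetoidReasoning

-- A partial homomorphism F up to arity h sends f to the system π ↦ F(f^π) of
-- h-ary minors; the system laws are the minor laws of F.  Conversely, an n-ary element (n ≤ h) is recovered from its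
-- system Z as Z(ι)^ρ, where ι : [n] → [h] is an injection with retraction ρ;
-- the compatibility of Z makes this independent of how a minor is reached.

retract≤ : ∀ {n h} → suc n ≤ h → Fin h → Fin (suc n)
retract≤ (s≤s z≤n)     _       = zero
retract≤ (s≤s (s≤s p)) zero    = zero
retract≤ (s≤s (s≤s p)) (suc i) = suc (retract≤ (s≤s p) i)

retract≤-inject≤ : ∀ {n h} (p : suc n ≤ h) (i : Fin (suc n)) →
                   retract≤ p (inject≤ i p) ≡ i
retract≤-inject≤ (s≤s z≤n)     zero    = refl
retract≤-inject≤ (s≤s (s≤s p)) zero    = refl
retract≤-inject≤ (s≤s (s≤s p)) (suc i) = cong suc (retract≤-inject≤ (s≤s p) i)

module MinionProperties (M : Minion) where
  open Minion M

  setoid : ℕ → Setoid 0ℓ 0ℓ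
  setoid n = record
    { Carrier       = Carrier n
    ; _≈_           = _≈_
    ; isEquivalence = record { refl = ≈-refl ; sym = ≈-sym ; trans = ≈-trans }
    }

  minor-section : ∀ {n k m} (f : Carrier n) (τ : Ar n → Ar m)
                  {s : Ar m → Ar k} {r : Ar k → Ar m} → (∀ i → r (s i) ≡ i) →
                  minor (minor f (s ∘ τ)) r ≈ minor f τ
  minor-section f τ {s} {r} r∘s≗id =
    ≈-trans (≈-sym (minor-∘ f r (s ∘ τ))) (minor-cong ≈-refl (r∘s≗id ∘ τ))

module _ {M N : Minion} where
  private
    module M = Minion M
    module N = Minion N
  open MinionProperties N using (setoid; minor-section)
  open Closure N

  systemOfMinors : ∀ {k n} → PartialHom (suc k) M N → M.Carrier n → System (suc k) n
  ζ (systemOfMinors F f) π = PartialHom.map F ≤-refl (M.minor f π)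
  system (systemOfMinors {k} F f) π₁ π₂ σ π₁≗σ∘π₂ = begin
    N.minor (F↾ (M.minor f π₂)) σ  ≈⟨ N.≈-sym (PartialHom.map-minor F ≤-refl ≤-refl _ σ) ⟩
    F↾ (M.minor (M.minor f π₂) σ)  ≈⟨ PartialHom.map-cong F ≤-refl (M.≈-sym (M.minor-∘ f σ π₂)) ⟩
    F↾ (M.minor f (σ ∘ π₂))        ≈⟨ PartialHom.map-cong F ≤-refl
                                         (M.minor-cong M.≈-refl (λ i → sym (π₁≗σ∘π₂ i))) ⟩
    F↾ (M.minor f π₁)              ∎
    where
    open SetoidReasoning (setoid _)
    F↾ : M.Carrier k → N.Carrier k
    F↾ = PartialHom.map F ≤-refl

  partialHom⇒closureHom : ∀ {h} → PartialHom h M N → Hom M (N ⁽ h ⁾)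
  -- N⁽0⁾ is the one-point minion.
  partialHom⇒closureHom {zero} _ = record
    { map       = λ _ → record { ζ = λ _ → tt ; system = λ _ _ _ _ → tt }
    ; map-cong  = λ _ _ → tt
    ; map-minor = λ _ _ _ → tt
    }
  partialHom⇒closureHom {suc k} F = record
    { map       = systemOfMinors F
    ; map-cong  = λ f≈g π → PartialHom.map-cong F ≤-refl (M.minor-cong f≈g (λ _ → refl))
    ; map-minor = λ f ρ π → PartialHom.map-cong F ≤-refl (M.≈-sym (M.minor-∘ f π ρ))
    }

  closureHom⇒partialHom : ∀ {h} → Hom M (N ⁽ h ⁾) → PartialHom h M N
  closureHom⇒partialHom {h} G = record
    { map       = restrict
    ; map-cong  = restrict-cong
    ; map-minor = restrict-minor
    }
    where
    inject : ∀ {n} → suc n ≤ h → Ar n → Fin h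
    inject p i = inject≤ i p

    -- Matching on p exposes h = suc _, where the codomain of ζ is a carrier of N.
    restrict : ∀ {n} → suc n ≤ h → M.Carrier n → N.Carrier n
    restrict p@(s≤s _) f = N.minor (ζ (Hom.map G f) (inject p)) (retract≤ p)

    restrict-cong : ∀ {n} (p : suc n ≤ h) {f g : M.Carrier n} →
                    f M.≈ g → restrict p f N.≈ restrict p g
    restrict-cong p@(s≤s _) f≈g = N.minor-cong (Hom.map-cong G f≈g (inject p)) (λ _ → refl)

    restrict-minor : ∀ {n m} (p : suc n ≤ h) (q : suc m ≤ h)
                     (f : M.Carrier n) (π : Ar n → Ar m) →
                     restrict q (M.minor f π) N.≈ N.minor (restrict p f) π
    restrict-minor p@(s≤s _) q@(s≤s _) f π = begin
      N.minor (ζ (Hom.map G (M.minor f π)) (inject q)) (retract≤ q)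
        ≈⟨ N.minor-cong (Hom.map-minor G f π (inject q)) (λ _ → refl) ⟩
      N.minor (ζ (Hom.map G f) (inject q ∘ π)) (retract≤ q)
        ≈⟨ N.minor-cong (N.≈-sym (system (Hom.map G f) _ (inject p) _ inject∘π-factors))
                        (λ _ → refl) ⟩
      N.minor (N.minor Z (inject q ∘ π ∘ retract≤ p)) (retract≤ q)
        ≈⟨ minor-section Z (π ∘ retract≤ p) (retract≤-inject≤ q) ⟩
      N.minor Z (π ∘ retract≤ p)
        ≈⟨ N.minor-∘ Z π (retract≤ p) ⟩
      N.minor (N.minor Z (retract≤ p)) π ∎
      where
      open SetoidReasoning (setoid _)
      Z : N.Carrier _
      Z = ζ (Hom.map G f) (inject p)
      inject∘π-factors : ∀ i → inject q (π i) ≡ inject q (π (retract≤ p (inject p i)))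
      inject∘π-factors i = cong (inject q ∘ π) (sym (retract≤-inject≤ p i))

proposition6p4 : (M N : Minion) (h : ℕ) →
    (PartialHom h M N → Hom M (N ⁽ h ⁾)) × (Hom M (N ⁽ h ⁾) → PartialHom h M N)
proposition6p4 M N h = partialHom⇒closureHom , closureHom⇒partialHom
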